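{- Let $T$ be an ultrametric tree with $n$ leaves whose common distance from the root is $1$, and let $D$ be its $n\times n$ leaf distance matrix. Then the matrix $\left(1-\frac1n\right)\mathbf{1}_{n\times n}-\frac12 D$ is positive semidefinite. Moreover, the constant $1-\frac1n$ is the smallest number with this property: for every $c<1-\frac1n$ there is an ultrametric tree with $n$ leaves at distance $1$ from the root whose leaf distance matrix $D$ satisfies that $c\,\mathbf{1}_{n\times n}-\frac12D$ is not positive semidefinite.
   Context: An ultrametric tree is a rooted tree with nonnegative edge lengths such that all leaves have the same distance from the root (distance between two vertices = sum of edge lengths along the unique path joining them). The leaf distance matrix $D$ has $(i,j)$ entry equal to the distance between leaves $i$ and $j$. $\mathbf{1}_{n\times n}$ is the $n\times n$ all-ones matrix. -}

module Defs where

open import Level using (Level; _⊔_) renaming (suc to lsuc)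
open import Data.Nat as ℕ using (ℕ; zero; suc)
open import Data.Fin using (Fin; zero; suc)
open import Data.List using (List; []; _∷_; _++_; map; length; lookup)
open import Data.Unit.Polymorphic using (⊤)
open import Data.Product using (_×_; _,_; Σ-syntax)
open import Relation.Nullary using (¬_; Dec; yes; no)
open import Relation.Binary.PropositionalEquality using (_≡_)
open import Algebra.Structures using (IsCommutativeRing)
open import Relation.Binary.Structures using (IsTotalOrder)

-- The inverse is a total operation, specified only on nonzero elements.

record OrderedField c ℓ₁ ℓ₂ : Set (lsuc (c ⊔ ℓ₁ ⊔ ℓ₂)) where
  infix  4 _≈_ _≤_ _<_
  infixl 6 _+_ _-_
  infixl 7 _*_
  field
    Carrier : Set c
    _≈_     : Carrier → Carrier → Set ℓ₁
    _≤_     : Carrier → Carrier → Set ℓ₂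
    _+_ _*_ : Carrier → Carrier → Carrier
    -_      : Carrier → Carrier
    0# 1#   : Carrier
    _⁻¹     : Carrier → Carrier
    isCommutativeRing : IsCommutativeRing _≈_ _+_ _*_ -_ 0# 1#
    isTotalOrder      : IsTotalOrder _≈_ _≤_
    +-monoˡ-≤ : ∀ {x y} z → x ≤ y → x + z ≤ y + z
    *-nonneg  : ∀ {x y} → 0# ≤ x → 0# ≤ y → 0# ≤ x * y
    0≉1       : ¬ (0# ≈ 1#)
    ⁻¹-cong   : ∀ {x y} → x ≈ y → x ⁻¹ ≈ y ⁻¹
    *-inverseʳ : ∀ x → ¬ (x ≈ 0#) → x * (x ⁻¹) ≈ 1#

  _-_ : Carrier → Carrier → Carrier
  x - y = x + (- y)

  _<_ : Carrier → Carrier → Set (ℓ₁ ⊔ ℓ₂)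
  x < y = (x ≤ y) × ¬ (x ≈ y)

  fromℕ : ℕ → Carrier
  fromℕ zero    = 0#
  fromℕ (suc n) = 1# + fromℕ n

  ½ : Carrier
  ½ = (1# + 1#) ⁻¹

  κ : ℕ → Carrier
  κ n = 1# - (fromℕ n) ⁻¹

  ∑ : ∀ {n} → (Fin n → Carrier) → Carrier
  ∑ {zero}  f = 0#
  ∑ {suc n} f = f zero + ∑ (λ i → f (suc i))

  PosSemidef : ∀ {n} → (Fin n → Fin n → Carrier) → Set (c ⊔ ℓ₂)
  PosSemidef {n} M = ∀ (v : Fin n → Carrier) →
    0# ≤ ∑ (λ i → ∑ (λ j → v i * M i j * v j))

-- Rooted trees with edge lengths in A: a node is a (possibly empty)
-- list of children, each attached by an edge with a length.
-- A node with no children is a leaf.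

data Tree {a} (A : Set a) : Set a where
  node : List (A × Tree A) → Tree A

-- A leaf is identified by its path from the root: the list of
-- (child index, edge length) steps.
Path : ∀ {a} → Set a → Set a
Path A = List (ℕ × A)

mutual
  leaves : ∀ {a} {A : Set a} → Tree A → List (Path A)
  leaves (node []) = [] ∷ []
  leaves (node (c ∷ cs)) = leavesFrom 0 (c ∷ cs)

  leavesFrom : ∀ {a} {A : Set a} → ℕ → List (A × Tree A) → List (Path A)
  leavesFrom k [] = []
  leavesFrom k ((e , t) ∷ cs) =
    map ((k , e) ∷_) (leaves t) ++ leavesFrom (suc k) cs

mutual
  AllEdges : ∀ {a p} {A : Set a} → (A → Set p) → Tree A → Set p
  AllEdges P (node cs) = AllEdgesL P cs

  AllEdgesL : ∀ {a p} {A : Set a} → (A → Set p) → List (A × Tree A) → Set p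
  AllEdgesL P [] = ⊤
  AllEdgesL P ((e , t) ∷ cs) = P e × AllEdges P t × AllEdgesL P cs

module _ {c ℓ₁ ℓ₂} (F : OrderedField c ℓ₁ ℓ₂) where
  open OrderedField F

  pathLength : Path Carrier → Carrier
  pathLength []            = 0#
  pathLength ((_ , e) ∷ p) = e + pathLength p

  -- distance between two leaves given by their root paths:
  -- the sum of edge lengths along the path joining them (through
  -- their lowest common ancestor)
  pathDist : Path Carrier → Path Carrier → Carrier
  pathDist [] q = pathLength q
  pathDist p [] = pathLength p
  pathDist ((k , e) ∷ p) ((l , f) ∷ q) with k ℕ.≟ l
  ... | yes _ = pathDist p q
  ... | no  _ = pathLength ((k , e) ∷ p) + pathLength ((l , f) ∷ q)

  nLeaves : Tree Carrier → ℕ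
  nLeaves t = length (leaves t)

  leafDist : (t : Tree Carrier) → Fin (nLeaves t) → Fin (nLeaves t) → Carrier
  leafDist t i j = pathDist (lookup (leaves t) i) (lookup (leaves t) j)

  IsUltrametric1 : Tree Carrier → Set (ℓ₁ ⊔ ℓ₂)
  IsUltrametric1 t =
    AllEdges (0# ≤_) t × (∀ (i : Fin (nLeaves t)) → pathLength (lookup (leaves t) i) ≈ 1#)

  shiftedMatrix : Carrier → (t : Tree Carrier) → Fin (nLeaves t) → Fin (nLeaves t) → Carrier
  shiftedMatrix x t i j = x - ½ * leafDist t i j

-- For leaves at common depth h, the entry h − ½·d(p, q) of h·1 − ½D is the depth of the lowest common
-- ancestor of p and q. Write Q(a) = aᵀ(h·1 − ½D)a and S(a) = Σ aᵢ for a weighting a of the n leaves;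
-- induction on the tree gives h·S(a)² ≤ n·Q(a). An edge of length e above a subtree adds e·S(a)² to Q(a),
-- while leaves below different children of a node do not interact, so the bound at a node follows from
-- those at its children by the Engel form of the Cauchy–Schwarz inequality. For h = 1 this says
-- aᵀ((1 − 1/n)·1 − ½D)a = Q(a) − S(a)²/n ≥ 0. For the star with n unit edges and a = (1, …, 1) one gets
-- aᵀ(c·1 − ½D)a = c·n² − (n² − n), which is negative as soon as c < 1 − 1/n.

module Submission where

open import Defs
open import Level using (Level; _⊔_)
open import Data.Nat as ℕ using (ℕ; zero; suc)
import Data.Nat.Properties as ℕP
open import Data.Fin using (Fin; zero; suc)
open import Data.Product using (_×_; _,_; proj₁; proj₂; map₂; ∃; ∃₂; Σ-syntax)
open import Data.Sum using (inj₁; inj₂)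
open import Data.List using (List; []; _∷_; _++_; map; length; lookup; replicate)
open import Data.List.Properties using (∷-injective; length-map; length-++; ++-identityʳ; tabulate-lookup)
open import Data.List.Relation.Unary.All as All using (All; []; _∷_)
open import Data.List.Relation.Unary.All.Properties using (map⁺; map⁻; ++⁺; ++⁻ˡ; ++⁻ʳ; tabulate⁺; tabulate⁻)
open import Data.Empty using (⊥-elim)
open import Data.Unit.Polymorphic using (tt)
open import Function using (_∘_)
open import Relation.Nullary using (¬_; yes; no)
open import Relation.Binary.PropositionalEquality as ≡ using (_≡_; _≢_)
open import Algebra.Bundles using (CommutativeSemiring; Ring)
open import Algebra.Structures using (IsCommutativeRing)
open import Relation.Binary.Structures using (IsTotalOrder)
open import Relation.Binary.Bundles using (Poset)
import Algebra.Properties.Ring as RingProperties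
import Algebra.Solver.Ring.NaturalCoefficients.Default as SemiringSolver
import Relation.Binary.Reasoning.Setoid as SetoidReasoning
import Relation.Binary.Reasoning.PartialOrder as PosetReasoning

map-≡-++⁻ : ∀ {a b} {A : Set a} {B : Set b} (f : A → B) (xs : List A) {ys zs} → map f xs ≡ ys ++ zs →
            ∃₂ λ xs₁ xs₂ → xs ≡ xs₁ ++ xs₂ × map f xs₁ ≡ ys × map f xs₂ ≡ zs
map-≡-++⁻ f xs       {[]}     eq = [] , xs , ≡.refl , ≡.refl , eq
map-≡-++⁻ f (x ∷ xs) {y ∷ ys} eq with ∷-injective eq
... | fx≡y , eq′ with map-≡-++⁻ f xs eq′
...   | xs₁ , xs₂ , ≡.refl , eq₁ , eq₂ = x ∷ xs₁ , xs₂ , ≡.refl , ≡.cong₂ _∷_ fx≡y eq₁ , eq₂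

map-proj₂-≡-map⁻ : ∀ {a b c} {A : Set a} {B : Set b} {C : Set c} (g : B → C) (W : List (A × C)) {L} →
                   map proj₂ W ≡ map g L → ∃ λ W′ → W ≡ map (map₂ g) W′ × map proj₂ W′ ≡ L
map-proj₂-≡-map⁻ g []            {[]}    _  = [] , ≡.refl , ≡.refl
map-proj₂-≡-map⁻ g ((a , _) ∷ W) {p ∷ L} eq with ∷-injective eq
... | ≡.refl , eq′ with map-proj₂-≡-map⁻ g W eq′
...   | W′ , ≡.refl , W′≡L = (a , p) ∷ W′ , ≡.refl , ≡.cong (p ∷_) W′≡L

All-map-proj₂ : ∀ {a b p} {A : Set a} {B : Set b} {P : B → Set p} {W : List (A × B)} {L} →
                map proj₂ W ≡ L → All P L → All (P ∘ proj₂) W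
All-map-proj₂ ≡.refl = map⁻

lookup⇒All : ∀ {a p} {A : Set a} {P : A → Set p} xs → (∀ i → P (lookup xs i)) → All P xs
lookup⇒All {P = P} xs Pxs = ≡.subst (All P) (tabulate-lookup xs) (tabulate⁺ Pxs)

All⇒lookup : ∀ {a p} {A : Set a} {P : A → Set p} {xs} → All P xs → ∀ i → P (lookup xs i)
All⇒lookup {P = P} {xs} Pxs = tabulate⁻ (≡.subst (All P) (≡.sym (tabulate-lookup xs)) Pxs)

module OrderedFieldProperties {c ℓ₁ ℓ₂} (F : OrderedField c ℓ₁ ℓ₂) where
  open OrderedField F public
  open IsCommutativeRing isCommutativeRing public hiding (_-_; zero)
  open IsTotalOrder isTotalOrder public
    using (total; antisym; ≤-respʳ-≈; ≤-respˡ-≈) renaming (refl to ≤-refl; trans to ≤-trans; reflexive to ≤-reflexive)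

  ring : Ring c ℓ₁
  ring = record { isRing = isRing }

  commutativeSemiring : CommutativeSemiring c ℓ₁
  commutativeSemiring = record { isCommutativeSemiring = isCommutativeSemiring }

  poset : Poset c ℓ₁ ℓ₂
  poset = record { isPartialOrder = IsTotalOrder.isPartialOrder isTotalOrder }

  open RingProperties ring public
    using (-‿involutive; -‿distribˡ-*; -‿distribʳ-*; //-rightDividesˡ; //-rightDividesʳ; -0#≈0#)
  open SemiringSolver commutativeSemiring public
    using (solve; _:=_; _:+_; _:*_; con)

  module ≈-Reasoning = SetoidReasoning setoid
  module ≤-Reasoning = PosetReasoning poset

  infix 8 _²
  _² : Carrier → Carrier
  x ² = x * x

  2# : Carrier
  2# = 1# + 1#

  +-monoʳ-≤ : ∀ z {x y} → x ≤ y → z + x ≤ z + y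
  +-monoʳ-≤ z {x} {y} x≤y = ≤-respˡ-≈ (+-comm x z) (≤-respʳ-≈ (+-comm y z) (+-monoˡ-≤ z x≤y))

  +-mono-≤ : ∀ {x y u v} → x ≤ y → u ≤ v → x + u ≤ y + v
  +-mono-≤ {y = y} {u} x≤y u≤v = ≤-trans (+-monoˡ-≤ u x≤y) (+-monoʳ-≤ y u≤v)

  x+[y-x]≈y : ∀ x y → x + (y - x) ≈ y
  x+[y-x]≈y x y = trans (+-comm x (y - x)) (//-rightDividesˡ x y)

  x+y≈z⇒y≈z-x : ∀ {x y z} → x + y ≈ z → y ≈ z - x
  x+y≈z⇒y≈z-x {x} {y} x+y≈z = trans (sym (//-rightDividesʳ x y)) (+-cong (trans (+-comm y x) x+y≈z) refl)

  x≤y⇒0≤y-x : ∀ {x y} → x ≤ y → 0# ≤ y - x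
  x≤y⇒0≤y-x {x} x≤y = ≤-respˡ-≈ (-‿inverseʳ x) (+-monoˡ-≤ (- x) x≤y)

  x≤0⇒0≤-x : ∀ {x} → x ≤ 0# → 0# ≤ - x
  x≤0⇒0≤-x {x} x≤0 = ≤-respʳ-≈ (+-identityˡ (- x)) (x≤y⇒0≤y-x x≤0)

  [-x]²≈x² : ∀ x → (- x) ² ≈ x ²
  [-x]²≈x² x = trans (sym (-‿distribˡ-* x (- x))) (trans (-‿cong (sym (-‿distribʳ-* x x))) (-‿involutive (x * x)))

  0≤x² : ∀ x → 0# ≤ x ²
  0≤x² x with total 0# x
  ... | inj₁ 0≤x = *-nonneg 0≤x 0≤x
  ... | inj₂ x≤0 = ≤-respʳ-≈ ([-x]²≈x² x) (*-nonneg (x≤0⇒0≤-x x≤0) (x≤0⇒0≤-x x≤0))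

  0≤1 : 0# ≤ 1#
  0≤1 = ≤-respʳ-≈ (*-identityˡ 1#) (0≤x² 1#)

  *-monoˡ-≤-nonneg : ∀ {z x y} → 0# ≤ z → x ≤ y → z * x ≤ z * y
  *-monoˡ-≤-nonneg {z} {x} {y} 0≤z x≤y = begin
    z * x                ≈⟨ +-identityʳ (z * x) ⟨
    z * x + 0#           ≤⟨ +-monoʳ-≤ (z * x) (*-nonneg 0≤z (x≤y⇒0≤y-x x≤y)) ⟩
    z * x + z * (y - x)  ≈⟨ distribˡ z x (y - x) ⟨
    z * (x + (y - x))    ≈⟨ *-cong refl (x+[y-x]≈y x y) ⟩
    z * y                ∎
    where open ≤-Reasoning

  *-monoʳ-≤-nonneg : ∀ {z x y} → 0# ≤ z → x ≤ y → x * z ≤ y * z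
  *-monoʳ-≤-nonneg {z} {x} {y} 0≤z x≤y =
    ≤-respˡ-≈ (*-comm z x) (≤-respʳ-≈ (*-comm z y) (*-monoˡ-≤-nonneg 0≤z x≤y))

  x⁻¹*x≈1 : ∀ x → ¬ (x ≈ 0#) → x ⁻¹ * x ≈ 1#
  x⁻¹*x≈1 x x≉0 = trans (*-comm (x ⁻¹) x) (*-inverseʳ x x≉0)

  0<x⇒x≉0 : ∀ {x} → 0# < x → ¬ (x ≈ 0#)
  0<x⇒x≉0 (_ , 0≉x) x≈0 = 0≉x (sym x≈0)

  *-cancelˡ-≤-pos : ∀ {z x y} → 0# < z → z * x ≤ z * y → x ≤ y
  *-cancelˡ-≤-pos {z} {x} {y} 0<z@(0≤z , _) zx≤zy with total x y
  ... | inj₁ x≤y = x≤y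
  ... | inj₂ y≤x = ≤-reflexive (begin
    x                 ≈⟨ *-identityˡ x ⟨
    1# * x            ≈⟨ *-cong (x⁻¹*x≈1 z (0<x⇒x≉0 0<z)) refl ⟨
    (z ⁻¹ * z) * x    ≈⟨ *-assoc _ _ _ ⟩
    z ⁻¹ * (z * x)    ≈⟨ *-cong refl (antisym zx≤zy (*-monoˡ-≤-nonneg 0≤z y≤x)) ⟩
    z ⁻¹ * (z * y)    ≈⟨ *-assoc _ _ _ ⟨
    (z ⁻¹ * z) * y    ≈⟨ *-cong (x⁻¹*x≈1 z (0<x⇒x≉0 0<z)) refl ⟩
    1# * y            ≈⟨ *-identityˡ y ⟩
    y                 ∎)
    where open ≈-Reasoning

  *-pos : ∀ {x y} → 0# < x → 0# < y → 0# < x * y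
  *-pos {x} {y} (0≤x , 0≉x) 0<y@(0≤y , _) = *-nonneg 0≤x 0≤y , λ 0≈xy → 0≉x (begin
    0#               ≈⟨ zeroˡ (y ⁻¹) ⟨
    0# * y ⁻¹        ≈⟨ *-cong 0≈xy refl ⟩
    (x * y) * y ⁻¹   ≈⟨ *-assoc x y (y ⁻¹) ⟩
    x * (y * y ⁻¹)   ≈⟨ *-cong refl (*-inverseʳ y (0<x⇒x≉0 0<y)) ⟩
    x * 1#           ≈⟨ *-identityʳ x ⟩
    x                ∎)
    where open ≈-Reasoning

  1≤x⇒0<x : ∀ {x} → 1# ≤ x → 0# < x
  1≤x⇒0<x 1≤x = ≤-trans 0≤1 1≤x , λ 0≈x → 0≉1 (antisym 0≤1 (≤-respʳ-≈ (sym 0≈x) 1≤x))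

  fromℕ-nonneg : ∀ n → 0# ≤ fromℕ n
  fromℕ-nonneg zero    = ≤-refl
  fromℕ-nonneg (suc n) = ≤-respˡ-≈ (+-identityʳ 0#) (+-mono-≤ 0≤1 (fromℕ-nonneg n))

  1≤fromℕ-suc : ∀ n → 1# ≤ fromℕ (suc n)
  1≤fromℕ-suc n = ≤-respˡ-≈ (+-identityʳ 1#) (+-monoʳ-≤ 1# (fromℕ-nonneg n))

  fromℕ-homo-+ : ∀ m n → fromℕ (m ℕ.+ n) ≈ fromℕ m + fromℕ n
  fromℕ-homo-+ zero    n = sym (+-identityˡ (fromℕ n))
  fromℕ-homo-+ (suc m) n = trans (+-cong refl (fromℕ-homo-+ m n)) (sym (+-assoc 1# (fromℕ m) (fromℕ n)))

  ½*[x+x]≈x : ∀ x → ½ * (x + x) ≈ x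
  ½*[x+x]≈x x = begin
    ½ * (x + x)   ≈⟨ *-cong refl (trans (distribʳ x 1# 1#) (+-cong (*-identityˡ x) (*-identityˡ x))) ⟨
    ½ * (2# * x)  ≈⟨ *-assoc ½ 2# x ⟨
    (½ * 2#) * x  ≈⟨ *-cong (x⁻¹*x≈1 2# 2≉0) refl ⟩
    1# * x        ≈⟨ *-identityˡ x ⟩
    x             ∎
    where
    open ≈-Reasoning
    2≉0 : ¬ (2# ≈ 0#)
    2≉0 2≈0 = 0<x⇒x≉0 (1≤x⇒0<x (1≤fromℕ-suc 1)) (trans (+-cong refl (+-identityʳ 1#)) 2≈0)

  2xy≤x²+y² : ∀ x y → 2# * (x * y) ≤ x ² + y ²
  2xy≤x²+y² x y = ≤-respˡ-≈ (+-identityˡ _) (≤-respʳ-≈ square-expansion (+-monoˡ-≤ (2# * (x * y)) (0≤x² (x - y))))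
    where
    open ≈-Reasoning
    expand : ∀ x m w → (x + m) ² + 2# * (x * w) ≈ x ² + m ² + 2# * (x * (m + w))
    expand = solve 3 (λ x m w → (x :+ m) :* (x :+ m) :+ (con 1 :+ con 1) :* (x :* w)
                             := x :* x :+ m :* m :+ (con 1 :+ con 1) :* (x :* (m :+ w))) refl
    square-expansion : (x - y) ² + 2# * (x * y) ≈ x ² + y ²
    square-expansion = begin
      (x - y) ² + 2# * (x * y)                    ≈⟨ expand x (- y) y ⟩
      x ² + (- y) ² + 2# * (x * (- y + y))        ≈⟨ +-cong (+-cong refl ([-x]²≈x² y))
                                                             (*-cong refl (*-cong refl (-‿inverseˡ y))) ⟩
      x ² + y ² + 2# * (x * 0#)                   ≈⟨ +-cong refl (trans (*-cong refl (zeroʳ x)) (zeroʳ 2#)) ⟩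
      x ² + y ² + 0#                              ≈⟨ +-identityʳ _ ⟩
      x ² + y ²                                   ∎

  -- Engel's form of Cauchy–Schwarz, (S₁ + S₂)²/(N₁ + N₂) ≤ S₁²/N₁ + S₂²/N₂, with denominators cleared.
  engel : ∀ {h N₁ N₂ Q₁ Q₂ S₁ S₂} → 0# ≤ h → 0# < N₁ → 0# < N₂ →
          h * S₁ ² ≤ N₁ * Q₁ → h * S₂ ² ≤ N₂ * Q₂ →
          h * (S₁ + S₂) ² ≤ (N₁ + N₂) * (Q₁ + Q₂)
  engel {h} {N₁} {N₂} {Q₁} {Q₂} {S₁} {S₂} 0≤h 0<N₁ 0<N₂ bound₁ bound₂ = begin
    h * (S₁ + S₂) ²                            ≈⟨ expand h S₁ S₂ ⟩
    h * S₁ ² + h * S₂ ² + h * (2# * (S₁ * S₂))  ≤⟨ +-mono-≤ (+-mono-≤ bound₁ bound₂) cross-term ⟩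
    N₁ * Q₁ + N₂ * Q₂ + (N₁ * Q₂ + N₂ * Q₁)    ≈⟨ collect N₁ N₂ Q₁ Q₂ ⟩
    (N₁ + N₂) * (Q₁ + Q₂)                      ∎
    where
    open ≤-Reasoning
    expand : ∀ h S₁ S₂ → h * (S₁ + S₂) ² ≈ h * S₁ ² + h * S₂ ² + h * (2# * (S₁ * S₂))
    expand = solve 3 (λ h S₁ S₂ → h :* ((S₁ :+ S₂) :* (S₁ :+ S₂))
                               := h :* (S₁ :* S₁) :+ h :* (S₂ :* S₂) :+ h :* ((con 1 :+ con 1) :* (S₁ :* S₂))) refl
    collect : ∀ N₁ N₂ Q₁ Q₂ → N₁ * Q₁ + N₂ * Q₂ + (N₁ * Q₂ + N₂ * Q₁) ≈ (N₁ + N₂) * (Q₁ + Q₂)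
    collect = solve 4 (λ N₁ N₂ Q₁ Q₂ → N₁ :* Q₁ :+ N₂ :* Q₂ :+ (N₁ :* Q₂ :+ N₂ :* Q₁)
                                     := (N₁ :+ N₂) :* (Q₁ :+ Q₂)) refl
    regroup : ∀ N₁ N₂ h S₁ S₂ → N₁ * N₂ * (h * (2# * (S₁ * S₂))) ≈ h * (2# * ((N₁ * S₂) * (N₂ * S₁)))
    regroup = solve 5 (λ N₁ N₂ h S₁ S₂ → N₁ :* N₂ :* (h :* ((con 1 :+ con 1) :* (S₁ :* S₂)))
                                      := h :* ((con 1 :+ con 1) :* ((N₁ :* S₂) :* (N₂ :* S₁)))) refl
    distribute : ∀ N₁ N₂ h S₁ S₂ → h * ((N₁ * S₂) ² + (N₂ * S₁) ²) ≈ N₁ ² * (h * S₂ ²) + N₂ ² * (h * S₁ ²)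
    distribute = solve 5 (λ N₁ N₂ h S₁ S₂ → h :* ((N₁ :* S₂) :* (N₁ :* S₂) :+ (N₂ :* S₁) :* (N₂ :* S₁))
                                         := N₁ :* N₁ :* (h :* (S₂ :* S₂)) :+ N₂ :* N₂ :* (h :* (S₁ :* S₁))) refl
    factor : ∀ N₁ N₂ Q₁ Q₂ → N₁ ² * (N₂ * Q₂) + N₂ ² * (N₁ * Q₁) ≈ N₁ * N₂ * (N₁ * Q₂ + N₂ * Q₁)
    factor = solve 4 (λ N₁ N₂ Q₁ Q₂ → N₁ :* N₁ :* (N₂ :* Q₂) :+ N₂ :* N₂ :* (N₁ :* Q₁)
                                    := N₁ :* N₂ :* (N₁ :* Q₂ :+ N₂ :* Q₁)) refl
    cross-term : h * (2# * (S₁ * S₂)) ≤ N₁ * Q₂ + N₂ * Q₁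
    cross-term = *-cancelˡ-≤-pos (*-pos 0<N₁ 0<N₂) (begin
      N₁ * N₂ * (h * (2# * (S₁ * S₂)))                ≈⟨ regroup N₁ N₂ h S₁ S₂ ⟩
      h * (2# * ((N₁ * S₂) * (N₂ * S₁)))              ≤⟨ *-monoˡ-≤-nonneg 0≤h (2xy≤x²+y² (N₁ * S₂) (N₂ * S₁)) ⟩
      h * ((N₁ * S₂) ² + (N₂ * S₁) ²)                 ≈⟨ distribute N₁ N₂ h S₁ S₂ ⟩
      N₁ ² * (h * S₂ ²) + N₂ ² * (h * S₁ ²)           ≤⟨ +-mono-≤ (*-monoˡ-≤-nonneg (0≤x² N₁) bound₂)
                                                                  (*-monoˡ-≤-nonneg (0≤x² N₂) bound₁) ⟩
      N₁ ² * (N₂ * Q₂) + N₂ ² * (N₁ * Q₁)             ≈⟨ factor N₁ N₂ Q₁ Q₂ ⟩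
      N₁ * N₂ * (N₁ * Q₂ + N₂ * Q₁)                   ∎)

  y≤x*z⇒0≤-x⁻¹*y+z : ∀ {x y z} → 0# < x → y ≤ x * z → 0# ≤ - (x ⁻¹) * y + z
  y≤x*z⇒0≤-x⁻¹*y+z {x} {y} {z} 0<x y≤xz = *-cancelˡ-≤-pos 0<x (begin
    x * 0#                        ≈⟨ zeroʳ x ⟩
    0#                            ≤⟨ x≤y⇒0≤y-x y≤xz ⟩
    x * z - y                     ≈⟨ +-comm (x * z) (- y) ⟩
    - y + x * z                   ≈⟨ +-cong x*[-x⁻¹*y]≈-y refl ⟨
    x * (- (x ⁻¹) * y) + x * z    ≈⟨ distribˡ x _ z ⟨
    x * (- (x ⁻¹) * y + z)        ∎)
    where
    open ≤-Reasoning
    x*[-x⁻¹*y]≈-y : x * (- (x ⁻¹) * y) ≈ - y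
    x*[-x⁻¹*y]≈-y = begin-equality
      x * (- (x ⁻¹) * y)   ≈⟨ *-cong refl (-‿distribˡ-* (x ⁻¹) y) ⟨
      x * - (x ⁻¹ * y)     ≈⟨ -‿distribʳ-* x (x ⁻¹ * y) ⟨
      - (x * (x ⁻¹ * y))   ≈⟨ -‿cong (*-assoc x (x ⁻¹) y) ⟨
      - (x * x ⁻¹ * y)     ≈⟨ -‿cong (*-cong (*-inverseʳ x (0<x⇒x≉0 0<x)) refl) ⟩
      - (1# * y)           ≈⟨ -‿cong (*-identityˡ y) ⟩
      - y                  ∎

  0≤[x-1]*y²+y⇒1-y⁻¹≤x : ∀ {x y} → 0# < y → 0# ≤ (x - 1#) * y ² + y → 1# - y ⁻¹ ≤ x
  0≤[x-1]*y²+y⇒1-y⁻¹≤x {x} {y} 0<y 0≤[x-1]y²+y = begin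
    1# - y ⁻¹                          ≈⟨ +-identityˡ _ ⟨
    0# + (1# - y ⁻¹)                   ≤⟨ +-monoˡ-≤ (1# - y ⁻¹) 0≤[x-1]+y⁻¹ ⟩
    (x - 1#) + y ⁻¹ + (1# - y ⁻¹)       ≈⟨ rearrange x (y ⁻¹) (- 1#) (- (y ⁻¹)) ⟩
    x + (1# - 1#) + (y ⁻¹ - y ⁻¹)      ≈⟨ +-cong (+-cong refl (-‿inverseʳ 1#)) (-‿inverseʳ (y ⁻¹)) ⟩
    x + 0# + 0#                        ≈⟨ trans (+-identityʳ _) (+-identityʳ x) ⟩
    x                                  ∎
    where
    open ≤-Reasoning
    rearrange : ∀ x i m₁ mᵢ → x + m₁ + i + (1# + mᵢ) ≈ x + (1# + m₁) + (i + mᵢ)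
    rearrange = solve 4 (λ x i m₁ mᵢ → x :+ m₁ :+ i :+ (con 1 :+ mᵢ) := x :+ (con 1 :+ m₁) :+ (i :+ mᵢ)) refl
    scale : ∀ i y z → i ² * (z * y ² + y) ≈ z * (y * i) ² + i * (y * i)
    scale = solve 3 (λ i y z → (i :* i) :* (z :* (y :* y) :+ y) := z :* ((y :* i) :* (y :* i)) :+ i :* (y :* i)) refl
    yy⁻¹≈1 : y * y ⁻¹ ≈ 1#
    yy⁻¹≈1 = *-inverseʳ y (0<x⇒x≉0 0<y)
    0≤[x-1]+y⁻¹ : 0# ≤ (x - 1#) + y ⁻¹
    0≤[x-1]+y⁻¹ = ≤-respʳ-≈ (begin-equality
      (y ⁻¹) ² * ((x - 1#) * y ² + y)             ≈⟨ scale (y ⁻¹) y (x - 1#) ⟩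
      (x - 1#) * (y * y ⁻¹) ² + y ⁻¹ * (y * y ⁻¹) ≈⟨ +-cong (*-cong refl (*-cong yy⁻¹≈1 yy⁻¹≈1)) (*-cong refl yy⁻¹≈1) ⟩
      (x - 1#) * (1# * 1#) + y ⁻¹ * 1#            ≈⟨ +-cong (trans (*-cong refl (*-identityˡ 1#)) (*-identityʳ _))
                                                             (*-identityʳ _) ⟩
      (x - 1#) + y ⁻¹                             ∎)
      (*-nonneg (0≤x² (y ⁻¹)) 0≤[x-1]y²+y)

module QuadraticForms {c ℓ₁ ℓ₂} (F : OrderedField c ℓ₁ ℓ₂) where
  open OrderedFieldProperties F

  private variable
    a b : Level
    A B : Set a

  ∑ₗ : (A → Carrier) → List A → Carrier
  ∑ₗ f []       = 0#
  ∑ₗ f (x ∷ xs) = f x + ∑ₗ f xs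

  ∑ₗ-cong : ∀ {f g : A → Carrier} {xs} → All (λ x → f x ≈ g x) xs → ∑ₗ f xs ≈ ∑ₗ g xs
  ∑ₗ-cong []         = refl
  ∑ₗ-cong (fx≈gx ∷ ps) = +-cong fx≈gx (∑ₗ-cong ps)

  ∑ₗ-zero : ∀ {f : A → Carrier} {xs} → All (λ x → f x ≈ 0#) xs → ∑ₗ f xs ≈ 0#
  ∑ₗ-zero []           = refl
  ∑ₗ-zero (fx≈0 ∷ ps) = trans (+-cong fx≈0 (∑ₗ-zero ps)) (+-identityʳ 0#)

  ∑ₗ-++ : ∀ (f : A → Carrier) xs ys → ∑ₗ f (xs ++ ys) ≈ ∑ₗ f xs + ∑ₗ f ys
  ∑ₗ-++ f []       ys = sym (+-identityˡ _)
  ∑ₗ-++ f (x ∷ xs) ys = trans (+-cong refl (∑ₗ-++ f xs ys)) (sym (+-assoc _ _ _))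

  ∑ₗ-+ : ∀ (f g : A → Carrier) xs → ∑ₗ (λ x → f x + g x) xs ≈ ∑ₗ f xs + ∑ₗ g xs
  ∑ₗ-+ f g []       = sym (+-identityʳ 0#)
  ∑ₗ-+ f g (x ∷ xs) = trans (+-cong refl (∑ₗ-+ f g xs)) (interchange (f x) (g x) _ _)
    where
    interchange : ∀ a b c d → a + b + (c + d) ≈ a + c + (b + d)
    interchange = solve 4 (λ a b c d → a :+ b :+ (c :+ d) := a :+ c :+ (b :+ d)) refl

  ∑ₗ-*ˡ : ∀ k (f : A → Carrier) xs → ∑ₗ (λ x → k * f x) xs ≈ k * ∑ₗ f xs
  ∑ₗ-*ˡ k f []       = sym (zeroʳ k)
  ∑ₗ-*ˡ k f (x ∷ xs) = trans (+-cong refl (∑ₗ-*ˡ k f xs)) (sym (distribˡ k _ _))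

  ∑ₗ-*ʳ : ∀ k (f : A → Carrier) xs → ∑ₗ (λ x → f x * k) xs ≈ ∑ₗ f xs * k
  ∑ₗ-*ʳ k f []       = sym (zeroˡ k)
  ∑ₗ-*ʳ k f (x ∷ xs) = trans (+-cong refl (∑ₗ-*ʳ k f xs)) (sym (distribʳ k _ _))

  ∑ₗ-map : ∀ (f : B → Carrier) (g : A → B) xs → ∑ₗ f (map g xs) ≡ ∑ₗ (λ x → f (g x)) xs
  ∑ₗ-map f g []       = ≡.refl
  ∑ₗ-map f g (x ∷ xs) = ≡.cong (f (g x) +_) (∑ₗ-map f g xs)

  ∑ₗ-universal : ∀ {f g : A → Carrier} xs → (∀ x → f x ≈ g x) → ∑ₗ f xs ≈ ∑ₗ g xs
  ∑ₗ-universal xs f≈g = ∑ₗ-cong (All.universal f≈g xs)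

  -- Vectors indexed by a list of points, as (weight, point) pairs: unlike Fin-indexed vectors
  -- they split along a splitting of the index list.
  Weighted : Set a → Set (c ⊔ a)
  Weighted A = List (Carrier × A)

  mass : Weighted A → Carrier
  mass = ∑ₗ proj₁

  quadForm : (A → A → Carrier) → Weighted A → Carrier
  quadForm G W = ∑ₗ (λ x → ∑ₗ (λ y → proj₁ x * G (proj₂ x) (proj₂ y) * proj₁ y) W) W

  quadForm-cong : ∀ {G G′ : A → A → Carrier} W → (∀ p q → G p q ≈ G′ p q) → quadForm G W ≈ quadForm G′ W
  quadForm-cong W G≈G′ =
    ∑ₗ-universal W (λ x → ∑ₗ-universal W (λ y → *-cong (*-cong refl (G≈G′ (proj₂ x) (proj₂ y))) refl))

  quadForm-map₂ : ∀ (G : B → B → Carrier) (f : A → B) W →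
                  quadForm G (map (map₂ f) W) ≈ quadForm (λ p q → G (f p) (f q)) W
  quadForm-map₂ G f W = trans (reflexive (∑ₗ-map _ (map₂ f) W))
                              (∑ₗ-universal W (λ x → reflexive (∑ₗ-map _ (map₂ f) W)))

  mass-map₂ : ∀ (f : A → B) W → mass (map (map₂ f) W) ≡ mass W
  mass-map₂ f W = ∑ₗ-map proj₁ (map₂ f) W

  quadForm-const+ : ∀ k (G : A → A → Carrier) W →
                    quadForm (λ p q → k + G p q) W ≈ k * mass W ² + quadForm G W
  quadForm-const+ k G W = begin
    quadForm (λ p q → k + G p q) W                         ≈⟨ ∑ₗ-universal W split-row ⟩
    ∑ₗ (λ x → k * (proj₁ x * mass W) + row x) W            ≈⟨ ∑ₗ-+ _ row W ⟩
    ∑ₗ (λ x → k * (proj₁ x * mass W)) W + quadForm G W     ≈⟨ +-cong (∑ₗ-*ˡ k _ W) refl ⟩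
    k * ∑ₗ (λ x → proj₁ x * mass W) W + quadForm G W       ≈⟨ +-cong (*-cong refl (∑ₗ-*ʳ (mass W) proj₁ W)) refl ⟩
    k * mass W ² + quadForm G W                            ∎
    where
    open ≈-Reasoning
    row : Carrier × _ → Carrier
    row x = ∑ₗ (λ y → proj₁ x * G (proj₂ x) (proj₂ y) * proj₁ y) W
    split-term : ∀ k a g b → a * (k + g) * b ≈ k * (a * b) + a * g * b
    split-term = solve 4 (λ k a g b → a :* (k :+ g) :* b := k :* (a :* b) :+ a :* g :* b) refl
    split-row : ∀ x → ∑ₗ (λ y → proj₁ x * (k + G (proj₂ x) (proj₂ y)) * proj₁ y) W ≈ k * (proj₁ x * mass W) + row x
    split-row (a , p) = begin
      ∑ₗ (λ y → a * (k + G p (proj₂ y)) * proj₁ y) W                  ≈⟨ ∑ₗ-universal W (λ y → split-term k a _ (proj₁ y)) ⟩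
      ∑ₗ (λ y → k * (a * proj₁ y) + a * G p (proj₂ y) * proj₁ y) W    ≈⟨ ∑ₗ-+ _ _ W ⟩
      ∑ₗ (λ y → k * (a * proj₁ y)) W + row (a , p)                    ≈⟨ +-cong (∑ₗ-*ˡ k _ W) refl ⟩
      k * ∑ₗ (λ y → a * proj₁ y) W + row (a , p)                      ≈⟨ +-cong (*-cong refl (∑ₗ-*ˡ a proj₁ W)) refl ⟩
      k * (a * mass W) + row (a , p)                                  ∎

  quadForm-++ : ∀ {p r} {P : A → Set p} {R : A → Set r} {G : A → A → Carrier} W₁ W₂ →
                (∀ {x y} → P x → R y → G x y ≈ 0# × G y x ≈ 0#) →
                All (λ x → P (proj₂ x)) W₁ → All (λ y → R (proj₂ y)) W₂ →
                quadForm G (W₁ ++ W₂) ≈ quadForm G W₁ + quadForm G W₂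
  quadForm-++ {A = A} {P = P} {R} {G} W₁ W₂ orthogonal P-W₁ R-W₂ = begin
    quadForm G (W₁ ++ W₂)                                             ≈⟨ ∑ₗ-++ _ W₁ W₂ ⟩
    ∑ₗ (λ x → row x (W₁ ++ W₂)) W₁ + ∑ₗ (λ y → row y (W₁ ++ W₂)) W₂  ≈⟨ +-cong (∑ₗ-cong (All.map row-left P-W₁))
                                                                                (∑ₗ-cong (All.map row-right R-W₂)) ⟩
    quadForm G W₁ + quadForm G W₂                                     ∎
    where
    open ≈-Reasoning
    row : Carrier × A → Weighted A → Carrier
    row x W = ∑ₗ (λ y → proj₁ x * G (proj₂ x) (proj₂ y) * proj₁ y) W
    row-zero : ∀ {x W} → All (λ y → G (proj₂ x) (proj₂ y) ≈ 0#) W → row x W ≈ 0#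
    row-zero = ∑ₗ-zero ∘ All.map (λ Gxy≈0 → trans (*-cong (trans (*-cong refl Gxy≈0) (zeroʳ _)) refl) (zeroˡ _))
    row-left : ∀ {x} → P (proj₂ x) → row x (W₁ ++ W₂) ≈ row x W₁
    row-left Px = trans (∑ₗ-++ _ W₁ W₂)
      (trans (+-cong refl (row-zero (All.map (λ Ry → proj₁ (orthogonal Px Ry)) R-W₂))) (+-identityʳ _))
    row-right : ∀ {y} → R (proj₂ y) → row y (W₁ ++ W₂) ≈ row y W₂
    row-right Ry = trans (∑ₗ-++ _ W₁ W₂)
      (trans (+-cong (row-zero (All.map (λ Px → proj₂ (orthogonal Px Ry)) P-W₁)) refl) (+-identityˡ _))

  quadForm-singleton : ∀ (G : A → A → Carrier) x → quadForm G (x ∷ []) ≈ G (proj₂ x) (proj₂ x) * proj₁ x ²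
  quadForm-singleton G (a , p) = singleton a (G p p)
    where
    singleton : ∀ a g → a * g * a + 0# + 0# ≈ g * (a * a)
    singleton = solve 2 (λ a g → a :* g :* a :+ con 0 :+ con 0 := g :* (a :* a)) refl

  weigh : (L : List A) → (Fin (length L) → Carrier) → Weighted A
  weigh []      v = []
  weigh (p ∷ L) v = (v zero , p) ∷ weigh L (λ i → v (suc i))

  map-proj₂-weigh : ∀ (L : List A) v → map proj₂ (weigh L v) ≡ L
  map-proj₂-weigh []      v = ≡.refl
  map-proj₂-weigh (p ∷ L) v = ≡.cong (p ∷_) (map-proj₂-weigh L (λ i → v (suc i)))

  length-weigh : ∀ (L : List A) v → length (weigh L v) ≡ length L
  length-weigh []      v = ≡.refl
  length-weigh (p ∷ L) v = ≡.cong suc (length-weigh L (λ i → v (suc i)))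

  mass-weigh-1 : ∀ (L : List A) → mass (weigh L (λ _ → 1#)) ≈ fromℕ (length L)
  mass-weigh-1 []      = refl
  mass-weigh-1 (p ∷ L) = +-cong refl (mass-weigh-1 L)

  ∑-cong : ∀ {n} {f g : Fin n → Carrier} → (∀ i → f i ≈ g i) → ∑ f ≈ ∑ g
  ∑-cong {zero}  f≈g = refl
  ∑-cong {suc n} f≈g = +-cong (f≈g zero) (∑-cong (λ i → f≈g (suc i)))

  ∑-weigh : ∀ (L : List A) v (f : Carrier × A → Carrier) → ∑ (λ i → f (v i , lookup L i)) ≈ ∑ₗ f (weigh L v)
  ∑-weigh []      v f = refl
  ∑-weigh (p ∷ L) v f = +-cong refl (∑-weigh L (λ i → v (suc i)) f)

  ∑∑-weigh : ∀ (G : A → A → Carrier) L v →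
             ∑ (λ i → ∑ (λ j → v i * G (lookup L i) (lookup L j) * v j)) ≈ quadForm G (weigh L v)
  ∑∑-weigh G L v = trans (∑-cong (λ i → ∑-weigh L v (λ y → v i * G (lookup L i) (proj₂ y) * proj₁ y)))
                         (∑-weigh L v (λ x → ∑ₗ (λ y → proj₁ x * G (proj₂ x) (proj₂ y) * proj₁ y) (weigh L v)))

  QuadFormBound : Carrier → (A → A → Carrier) → Weighted A → Set ℓ₂
  QuadFormBound h G W = h * mass W ² ≤ fromℕ (length W) * quadForm G W

  bound-cong : ∀ {h h′} {G G′ : A → A → Carrier} W → h ≈ h′ → (∀ p q → G p q ≈ G′ p q) →
               QuadFormBound h G W → QuadFormBound h′ G′ W
  bound-cong W h≈h′ G≈G′ = ≤-respˡ-≈ (*-cong h≈h′ refl) ∘ ≤-respʳ-≈ (*-cong refl (quadForm-cong W G≈G′))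

  bound-[] : ∀ h (G : A → A → Carrier) → QuadFormBound h G []
  bound-[] h G = ≤-reflexive (trans (*-cong refl (zeroˡ 0#)) (trans (zeroʳ h) (sym (zeroˡ 0#))))

  bound-singleton : ∀ {h} (G : A → A → Carrier) x → G (proj₂ x) (proj₂ x) ≈ h → QuadFormBound h G (x ∷ [])
  bound-singleton {h = h} G x@(a , p) Gpp≈h = ≤-reflexive (begin
    h * (a + 0#) ²            ≈⟨ *-cong (sym Gpp≈h) (*-cong (+-identityʳ a) (+-identityʳ a)) ⟩
    G p p * a ²               ≈⟨ quadForm-singleton G x ⟨
    quadForm G (x ∷ [])       ≈⟨ *-identityˡ _ ⟨
    1# * quadForm G (x ∷ [])  ≈⟨ *-cong (+-identityʳ 1#) refl ⟨
    (1# + 0#) * quadForm G (x ∷ []) ∎)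
    where open ≈-Reasoning

  bound-const+ : ∀ {e h} {G : A → A → Carrier} W → 0# ≤ e →
                 QuadFormBound h G W → QuadFormBound (e + h) (λ p q → e + G p q) W
  bound-const+ {e = e} {h} {G} W 0≤e bound = begin
    (e + h) * mass W ²                     ≈⟨ distribʳ _ e h ⟩
    e * mass W ² + h * mass W ²            ≤⟨ +-mono-≤ (≤-length* W) bound ⟩
    N * (e * mass W ²) + N * quadForm G W  ≈⟨ distribˡ N _ _ ⟨
    N * (e * mass W ² + quadForm G W)      ≈⟨ *-cong refl (quadForm-const+ e G W) ⟨
    N * quadForm (λ p q → e + G p q) W     ∎
    where
    open ≤-Reasoning
    N : Carrier
    N = fromℕ (length W)
    ≤-length* : ∀ W → e * mass W ² ≤ fromℕ (length W) * (e * mass W ²)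
    ≤-length* []      = ≤-reflexive (trans (*-cong refl (zeroˡ 0#)) (trans (zeroʳ e) (sym (zeroˡ _))))
    ≤-length* (x ∷ W) = ≤-respˡ-≈ (*-identityˡ _) (*-monoʳ-≤-nonneg (*-nonneg 0≤e (0≤x² _)) (1≤fromℕ-suc (length W)))

  bound-++ : ∀ {p r} {P : A → Set p} {R : A → Set r} {h} {G : A → A → Carrier} W₁ W₂ → 0# ≤ h →
             (∀ {x y} → P x → R y → G x y ≈ 0# × G y x ≈ 0#) →
             All (λ x → P (proj₂ x)) W₁ → All (λ y → R (proj₂ y)) W₂ →
             QuadFormBound h G W₁ → QuadFormBound h G W₂ → QuadFormBound h G (W₁ ++ W₂)
  bound-++ [] W₂ _ _ _ _ _ bound₂ = bound₂
  bound-++ W₁ [] _ _ _ _ bound₁ _ rewrite ++-identityʳ W₁ = bound₁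
  bound-++ {h = h} {G} W₁@(x ∷ W₁′) W₂@(y ∷ W₂′) 0≤h orthogonal P-W₁ R-W₂ bound₁ bound₂ = begin
    h * mass (W₁ ++ W₂) ²                             ≈⟨ *-cong refl (*-cong (∑ₗ-++ proj₁ W₁ W₂) (∑ₗ-++ proj₁ W₁ W₂)) ⟩
    h * (mass W₁ + mass W₂) ²                         ≤⟨ engel 0≤h (1≤x⇒0<x (1≤fromℕ-suc (length W₁′)))
                                                               (1≤x⇒0<x (1≤fromℕ-suc (length W₂′))) bound₁ bound₂ ⟩
    (fromℕ (length W₁) + fromℕ (length W₂)) * (quadForm G W₁ + quadForm G W₂)
      ≈⟨ *-cong (trans (reflexive (≡.cong fromℕ (length-++ W₁))) (fromℕ-homo-+ (length W₁) (length W₂)))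
                (quadForm-++ W₁ W₂ orthogonal P-W₁ R-W₂) ⟨
    fromℕ (length (W₁ ++ W₂)) * quadForm G (W₁ ++ W₂) ∎
    where open ≤-Reasoning

  bound-map₂ : ∀ {h} {G : B → B → Carrier} (f : A → B) W →
               QuadFormBound h (λ p q → G (f p) (f q)) W → QuadFormBound h G (map (map₂ f) W)
  bound-map₂ {h = h} {G} f W bound = begin
    h * mass (map (map₂ f) W) ²                                  ≡⟨ ≡.cong (λ m → h * m ²) (mass-map₂ f W) ⟩
    h * mass W ²                                                 ≤⟨ bound ⟩
    fromℕ (length W) * quadForm (λ p q → G (f p) (f q)) W        ≈⟨ *-cong (reflexive (≡.cong fromℕ (length-map (map₂ f) W)))
                                                                           (quadForm-map₂ G f W) ⟨
    fromℕ (length (map (map₂ f) W)) * quadForm G (map (map₂ f) W) ∎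
    where open ≤-Reasoning

module UltrametricTrees {c ℓ₁ ℓ₂} (F : OrderedField c ℓ₁ ℓ₂) where
  open OrderedFieldProperties F
  open QuadraticForms F

  shiftedKernel : Carrier → Path Carrier → Path Carrier → Carrier
  shiftedKernel h p q = h - ½ * pathDist F p q

  pathDist-∷-same : ∀ k e f p q → pathDist F ((k , e) ∷ p) ((k , f) ∷ q) ≡ pathDist F p q
  pathDist-∷-same k e f p q with k ℕ.≟ k
  ... | yes _  = ≡.refl
  ... | no k≢k = ⊥-elim (k≢k ≡.refl)

  pathDist-∷-distinct : ∀ {k l} e f p q → k ≢ l →
                        pathDist F ((k , e) ∷ p) ((l , f) ∷ q) ≡ pathLength F ((k , e) ∷ p) + pathLength F ((l , f) ∷ q)
  pathDist-∷-distinct {k} {l} e f p q k≢l with k ℕ.≟ l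
  ... | yes k≡l = ⊥-elim (k≢l k≡l)
  ... | no _    = ≡.refl

  pathDist-self : ∀ p → pathDist F p p ≡ 0#
  pathDist-self []            = ≡.refl
  pathDist-self ((k , e) ∷ p) = ≡.trans (pathDist-∷-same k e e p p) (pathDist-self p)

  shiftedKernel-self : ∀ h p → shiftedKernel h p p ≈ h
  shiftedKernel-self h p = begin
    h - ½ * pathDist F p p  ≡⟨ ≡.cong (λ d → h - ½ * d) (pathDist-self p) ⟩
    h - ½ * 0#              ≈⟨ +-cong refl (trans (-‿cong (zeroʳ ½)) -0#≈0#) ⟩
    h + 0#                  ≈⟨ +-identityʳ h ⟩
    h                       ∎
    where open ≈-Reasoning

  shiftedKernel-∷ : ∀ h k e p q → shiftedKernel h ((k , e) ∷ p) ((k , e) ∷ q) ≡ shiftedKernel h p q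
  shiftedKernel-∷ h k e p q = ≡.cong (λ d → h - ½ * d) (pathDist-∷-same k e e p q)

  shiftedKernel-distinct : ∀ {h k l} e f p q → k ≢ l →
                           pathLength F ((k , e) ∷ p) ≈ h → pathLength F ((l , f) ∷ q) ≈ h →
                           shiftedKernel h ((k , e) ∷ p) ((l , f) ∷ q) ≈ 0#
  shiftedKernel-distinct {h} {k} {l} e f p q k≢l |p|≈h |q|≈h = begin
    h - ½ * pathDist F p′ q′                      ≡⟨ ≡.cong (λ d → h - ½ * d) (pathDist-∷-distinct e f p q k≢l) ⟩
    h - ½ * (pathLength F p′ + pathLength F q′)   ≈⟨ +-cong refl (-‿cong (*-cong refl (+-cong |p|≈h |q|≈h))) ⟩
    h - ½ * (h + h)                               ≈⟨ +-cong refl (-‿cong (½*[x+x]≈x h)) ⟩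
    h - h                                         ≈⟨ -‿inverseʳ h ⟩
    0#                                            ∎
    where
    open ≈-Reasoning
    p′ q′ : Path Carrier
    p′ = (k , e) ∷ p
    q′ = (l , f) ∷ q

  data HeadIndex (P : ℕ → Set) : Path Carrier → Set c where
    head : ∀ {k e p} → P k → HeadIndex P ((k , e) ∷ p)

  HeadIndex-map : ∀ {P Q : ℕ → Set} → (∀ {n} → P n → Q n) → ∀ {p} → HeadIndex P p → HeadIndex Q p
  HeadIndex-map P⇒Q (head Pk) = head (P⇒Q Pk)

  UnderChild PastChild : ℕ → Carrier → Path Carrier → Set (c ⊔ ℓ₁)
  UnderChild k h p = HeadIndex (_≡ k) p × pathLength F p ≈ h
  PastChild  k h q = HeadIndex (k ℕ.<_) q × pathLength F q ≈ h

  shiftedKernel-orthogonal : ∀ {h k p q} → UnderChild k h p → PastChild k h q →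
                             shiftedKernel h p q ≈ 0# × shiftedKernel h q p ≈ 0#
  shiftedKernel-orthogonal (head ≡.refl , |p|≈h) (head k<l , |q|≈h) =
    shiftedKernel-distinct _ _ _ _ (ℕP.<⇒≢ k<l) |p|≈h |q|≈h ,
    shiftedKernel-distinct _ _ _ _ (ℕP.<⇒≢ k<l ∘ ≡.sym) |q|≈h |p|≈h

  shiftedKernel-+ : ∀ a b p q → shiftedKernel (a + b) p q ≈ a + shiftedKernel b p q
  shiftedKernel-+ a b p q = +-assoc a b _

  shiftedKernel-cong : ∀ {a b} → a ≈ b → ∀ p q → shiftedKernel a p q ≈ shiftedKernel b p q
  shiftedKernel-cong a≈b p q = +-cong a≈b refl

  leavesFrom-heads : ∀ k cs → All (HeadIndex (k ℕ.≤_)) (leavesFrom k cs)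
  leavesFrom-heads k []             = []
  leavesFrom-heads k ((e , t) ∷ cs) =
    ++⁺ (map⁺ (All.universal (λ _ → head ℕP.≤-refl) (leaves t)))
        (All.map (HeadIndex-map ℕP.<⇒≤) (leavesFrom-heads (suc k) cs))

  nLeaves-nonzero : ∀ t → ∃ λ n → nLeaves F t ≡ suc n
  nLeaves-nonzero (node [])             = 0 , ≡.refl
  nLeaves-nonzero (node ((e , t) ∷ cs)) with leaves t | nLeaves-nonzero t
  ... | []    | _ , ()
  ... | _ ∷ _ | _      = _ , ≡.refl

  lengths-below : ∀ {h k e} L → All (λ p → pathLength F p ≈ h) (map ((k , e) ∷_) L) →
                  All (λ p → pathLength F p ≈ h - e) L
  lengths-below L = All.map x+y≈z⇒y≈z-x ∘ map⁻

  mutual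
    height-nonneg : ∀ t {h} → AllEdges (0# ≤_) t → All (λ p → pathLength F p ≈ h) (leaves t) → 0# ≤ h
    height-nonneg (node [])             _                   (0≈h ∷ []) = ≤-reflexive 0≈h
    height-nonneg (node ((e , t) ∷ cs)) (0≤e , edges-t , _) lengths    = child-height-nonneg t 0≤e edges-t (++⁻ˡ _ lengths)

    child-height-nonneg : ∀ {k e h} t → 0# ≤ e → AllEdges (0# ≤_) t →
                          All (λ p → pathLength F p ≈ h) (map ((k , e) ∷_) (leaves t)) → 0# ≤ h
    child-height-nonneg {e = e} t 0≤e edges-t lengths = ≤-respʳ-≈ (x+[y-x]≈y e _)
      (≤-respˡ-≈ (+-identityʳ 0#) (+-mono-≤ 0≤e (height-nonneg t edges-t (lengths-below (leaves t) lengths))))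

  prefix-bound : ∀ {h k e} W → 0# ≤ e → QuadFormBound (h - e) (shiftedKernel (h - e)) W →
                 QuadFormBound h (shiftedKernel h) (map (map₂ ((k , e) ∷_)) W)
  prefix-bound {h} {k} {e} W 0≤e =
    bound-map₂ ((k , e) ∷_) W ∘ bound-cong W (x+[y-x]≈y e h) kernel ∘ bound-const+ W 0≤e
    where
    kernel : ∀ p q → e + shiftedKernel (h - e) p q ≈ shiftedKernel h ((k , e) ∷ p) ((k , e) ∷ q)
    kernel p q = begin
      e + shiftedKernel (h - e) p q             ≈⟨ shiftedKernel-+ e (h - e) p q ⟨
      shiftedKernel (e + (h - e)) p q           ≈⟨ shiftedKernel-cong (x+[y-x]≈y e h) p q ⟩
      shiftedKernel h p q                       ≡⟨ shiftedKernel-∷ h k e p q ⟨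
      shiftedKernel h ((k , e) ∷ p) ((k , e) ∷ q) ∎
      where open ≈-Reasoning

  mutual
    tree-bound : ∀ t {h} → AllEdges (0# ≤_) t → All (λ p → pathLength F p ≈ h) (leaves t) →
                 ∀ W → map proj₂ W ≡ leaves t → QuadFormBound h (shiftedKernel h) W
    tree-bound (node [])       {h} _     _       (x ∷ []) _        =
      bound-singleton (shiftedKernel h) x (shiftedKernel-self h (proj₂ x))
    tree-bound (node (c ∷ cs))     edges lengths W        W-leaves =
      forest-bound 0 (c ∷ cs) edges lengths W W-leaves

    forest-bound : ∀ k cs {h} → AllEdgesL (0# ≤_) cs → All (λ p → pathLength F p ≈ h) (leavesFrom k cs) →
                   ∀ W → map proj₂ W ≡ leavesFrom k cs → QuadFormBound h (shiftedKernel h) W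
    forest-bound k [] {h} _ _ [] _ = bound-[] h (shiftedKernel h)
    forest-bound k ((e , t) ∷ cs) {h} (0≤e , edges-t , edges-cs) lengths W W-leaves
      with map-≡-++⁻ proj₂ W W-leaves
    ... | W₁ , W₂ , ≡.refl , W₁-leaves , W₂-leaves
      with map-proj₂-≡-map⁻ ((k , e) ∷_) W₁ W₁-leaves
    ... | W′ , ≡.refl , W′-leaves =
      bound-++ {P = UnderChild k h} {R = PastChild k h} W₁ W₂ 0≤h shiftedKernel-orthogonal
        (All-map-proj₂ W₁-leaves (All.zip (map⁺ (All.universal (λ _ → head ≡.refl) (leaves t)) , lengths₁)))
        (All-map-proj₂ W₂-leaves (All.zip (leavesFrom-heads (suc k) cs , lengths₂)))
        (prefix-bound W′ 0≤e (tree-bound t edges-t lengths-t W′ W′-leaves))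
        (forest-bound (suc k) cs edges-cs lengths₂ W₂ W₂-leaves)
      where
      lengths₁ : All (λ p → pathLength F p ≈ h) (map ((k , e) ∷_) (leaves t))
      lengths₁ = ++⁻ˡ (map ((k , e) ∷_) (leaves t)) lengths
      lengths₂ : All (λ p → pathLength F p ≈ h) (leavesFrom (suc k) cs)
      lengths₂ = ++⁻ʳ (map ((k , e) ∷_) (leaves t)) lengths
      lengths-t : All (λ p → pathLength F p ≈ h - e) (leaves t)
      lengths-t = lengths-below (leaves t) lengths₁
      0≤h : 0# ≤ h
      0≤h = child-height-nonneg t 0≤e edges-t lengths₁

  shiftedMatrix-psd : ∀ t → IsUltrametric1 F t → PosSemidef (shiftedMatrix F (κ (nLeaves F t)) t)
  shiftedMatrix-psd t (edges , lengths) v = ≤-respʳ-≈ (sym (∑∑-weigh (shiftedKernel (κ n)) L v)) (begin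
    0#                                                   ≤⟨ y≤x*z⇒0≤-x⁻¹*y+z 0<N bound ⟩
    - (N ⁻¹) * mass W ² + quadForm (shiftedKernel 1#) W  ≈⟨ quadForm-const+ (- (N ⁻¹)) (shiftedKernel 1#) W ⟨
    quadForm (λ p q → - (N ⁻¹) + shiftedKernel 1# p q) W  ≈⟨ quadForm-cong W kernel ⟨
    quadForm (shiftedKernel (κ n)) W                     ∎)
    where
    open ≤-Reasoning
    L : List (Path Carrier)
    L = leaves t
    n : ℕ
    n = length L
    N : Carrier
    N = fromℕ n
    W : Weighted (Path Carrier)
    W = weigh L v
    0<N : 0# < N
    0<N with nLeaves-nonzero t
    ... | m , n≡1+m = ≡.subst (λ k → 0# < fromℕ k) (≡.sym n≡1+m) (1≤x⇒0<x (1≤fromℕ-suc m))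
    bound : mass W ² ≤ N * quadForm (shiftedKernel 1#) W
    bound = ≤-respˡ-≈ (*-identityˡ _) (≤-respʳ-≈ (*-cong (reflexive (≡.cong fromℕ (length-weigh L v))) refl)
      (tree-bound t edges (lookup⇒All L lengths) W (map-proj₂-weigh L v)))
    kernel : ∀ p q → shiftedKernel (κ n) p q ≈ - (N ⁻¹) + shiftedKernel 1# p q
    kernel p q = trans (shiftedKernel-cong (+-comm 1# _) p q) (shiftedKernel-+ (- (N ⁻¹)) 1# p q)

  spoke : Carrier × Tree Carrier
  spoke = 1# , node []

  star : ℕ → Tree Carrier
  star n = node (replicate n spoke)

  star-nLeaves : ∀ k n → length (leavesFrom k (replicate n spoke)) ≡ n
  star-nLeaves k zero    = ≡.refl
  star-nLeaves k (suc n) = ≡.cong suc (star-nLeaves (suc k) n)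

  star-edges : ∀ n → AllEdgesL (0# ≤_) (replicate n spoke)
  star-edges zero    = tt
  star-edges (suc n) = 0≤1 , tt , star-edges n

  star-lengths : ∀ k n → All (λ p → pathLength F p ≈ 1#) (leavesFrom k (replicate n spoke))
  star-lengths k zero    = []
  star-lengths k (suc n) = +-identityʳ 1# ∷ star-lengths (suc k) n

  star-quadForm : ∀ k n → quadForm (shiftedKernel 1#) (weigh (leavesFrom k (replicate n spoke)) (λ _ → 1#)) ≈ fromℕ n
  star-quadForm k zero    = refl
  star-quadForm k (suc n) = trans
    (quadForm-++ {P = UnderChild k 1#} {R = PastChild k 1#} (x ∷ []) W shiftedKernel-orthogonal
       ((head ≡.refl , +-identityʳ 1#) ∷ [])
       (All-map-proj₂ (map-proj₂-weigh _ _) (All.zip (leavesFrom-heads (suc k) (replicate n spoke) , star-lengths (suc k) n))))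
    (+-cong (trans (quadForm-singleton (shiftedKernel 1#) x)
              (trans (*-cong (shiftedKernel-self 1# (proj₂ x)) (*-identityʳ 1#)) (*-identityʳ 1#)))
            (star-quadForm (suc k) n))
    where
    x : Carrier × Path Carrier
    x = 1# , (k , 1#) ∷ []
    W : Weighted (Path Carrier)
    W = weigh (leavesFrom (suc k) (replicate n spoke)) (λ _ → 1#)

  star-psd⇒κ≤ : ∀ m {x} → PosSemidef (shiftedMatrix F x (star (suc m))) → κ (suc m) ≤ x
  star-psd⇒κ≤ m {x} psd = 0≤[x-1]*y²+y⇒1-y⁻¹≤x (1≤x⇒0<x (1≤fromℕ-suc m)) (begin
    0#                                                    ≤⟨ psd (λ _ → 1#) ⟩
    ∑ (λ i → ∑ (λ j → 1# * shiftedMatrix F x (star (suc m)) i j * 1#))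
                                                          ≈⟨ ∑∑-weigh (shiftedKernel x) L (λ _ → 1#) ⟩
    quadForm (shiftedKernel x) W                          ≈⟨ quadForm-cong W kernel ⟩
    quadForm (λ p q → (x - 1#) + shiftedKernel 1# p q) W  ≈⟨ quadForm-const+ (x - 1#) (shiftedKernel 1#) W ⟩
    (x - 1#) * mass W ² + quadForm (shiftedKernel 1#) W   ≈⟨ +-cong (*-cong refl (*-cong mass-W mass-W))
                                                                    (star-quadForm 0 (suc m)) ⟩
    (x - 1#) * N ² + N                                    ∎)
    where
    open ≤-Reasoning
    L : List (Path Carrier)
    L = leaves (star (suc m))
    W : Weighted (Path Carrier)
    W = weigh L (λ _ → 1#)
    N : Carrier
    N = fromℕ (suc m)
    mass-W : mass W ≈ N
    mass-W = trans (mass-weigh-1 L) (reflexive (≡.cong fromℕ (star-nLeaves 0 (suc m))))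
    kernel : ∀ p q → shiftedKernel x p q ≈ (x - 1#) + shiftedKernel 1# p q
    kernel p q = trans (shiftedKernel-cong (sym (//-rightDividesˡ 1# x)) p q) (shiftedKernel-+ (x - 1#) 1# p q)

  κ-optimal : ∀ n → 1 ℕ.≤ n → ∀ x → x < κ n →
              Σ[ t ∈ Tree Carrier ] (nLeaves F t ≡ n × IsUltrametric1 F t × ¬ PosSemidef (shiftedMatrix F x t))
  κ-optimal (suc m) _ x (x≤κ , x≉κ) =
    star (suc m) , star-nLeaves 0 (suc m) , (star-edges (suc m) , leaf-lengths) ,
    λ psd → x≉κ (antisym x≤κ (star-psd⇒κ≤ m psd))
    where
    leaf-lengths : ∀ i → pathLength F (lookup (leaves (star (suc m))) i) ≈ 1#
    leaf-lengths = All⇒lookup (star-lengths 0 (suc m))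

open import Data.Nat using (_≤_)

theorem1p8 : ∀ {c ℓ₁ ℓ₂} (F : OrderedField c ℓ₁ ℓ₂) →
    ((t : Tree (OrderedField.Carrier F)) → IsUltrametric1 F t →
      OrderedField.PosSemidef F (shiftedMatrix F (OrderedField.κ F (nLeaves F t)) t))
    ×
    ((n : ℕ) → 1 ≤ n → (x : OrderedField.Carrier F) → OrderedField._<_ F x (OrderedField.κ F n) →
      Σ[ t ∈ Tree (OrderedField.Carrier F) ]
        (nLeaves F t ≡ n × IsUltrametric1 F t × ¬ OrderedField.PosSemidef F (shiftedMatrix F x t)))
theorem1p8 F = shiftedMatrix-psd , κ-optimal
  where open UltrametricTrees F
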